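{- Let $p,q>1$ be relatively prime integers, $k_0=p^{ -1}\bmod q$ and $\ell_0=q^{ -1}\bmod p$. Then for all $U\in\mathbb{N}$, $$\Omega(pqU)={}^p\Omega(qU)+{}^q\big(\Omega(pU)\setminus{}^p\Omega(U)\big),\qquad \Omega(pqU+1)={}^{1p}\Omega(qU)+{}^{1q}\big(\Omega(pU)\setminus{}^p\Omega(U)\big),$$ and for $1<r<pq$, $$\Omega(pqU+r)=\begin{cases}{}^p\Omega(qU+k_0)+{}^{1q}\Omega(pU+p-\ell_0)&\text{if } r=k_0p,\\ {}^q\Omega(pU+\ell_0)+{}^{1p}\Omega(qU+q-k_0)&\text{if } r=\ell_0q,\\ {}^p\Omega(qU+k)&\text{if } r=kp,\ k\ne k_0,\\ {}^{1p}\Omega(qU+k)&\text{if } r=kp+1,\ k\ne q-k_0,\\ {}^q\Omega(pU+\ell)&\text{if } r=\ell q,\ \ell\ne\ell_0,\\ {}^{1q}\Omega(pU+\ell)&\text{if } r=\ell q+1,\ \ell\ne p-\ell_0,\\ \emptyset&\text{otherwise,}\end{cases}$$ where $+$ denotes disjoint union.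
   Context: A strictly chained $(p,q)$-ary partition of $U$ is a finite sequence of distinct positive integers of the form $p^aq^b$ ($a,b\ge 0$) summing to $U$, in decreasing order, each part being a multiple of the next one. $\Omega(U)$ is the set of such partitions of $U$; $\Omega(0)=\{()\}$ and $\Omega(x)=\emptyset$ if $x$ is not a nonnegative integer. For a set $\Omega$ of partitions: ${}^p\Omega$ (resp. ${}^q\Omega$) multiplies every part by $p$ (resp. $q$); ${}^1\Omega$: if $\min(p,q)=2$, increase the binary amount (sum of parts that are powers of 2, or 0 if none) of each partition by $1$ (rewriting the power-of-2 parts as the binary expansion of the new amount); if $\min(p,q)>2$, append a part $1$ to each partition. ${}^{1p}\Omega$ means ${}^1({}^p\Omega)$ and ${}^{1q}\Omega$ means ${}^1({}^q\Omega)$. -}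

module Defs where

open import Level using (0ℓ)
open import Data.Bool using (Bool; true; false; if_then_else_; not)
open import Data.Nat using (ℕ; zero; suc; _+_; _*_; _^_; _<_; _≡ᵇ_; _⊓_)
open import Data.Nat.DivMod using (_/_; _%_)
open import Data.Nat.Divisibility using (_∣_)
open import Data.List using (List; []; _∷_; _++_; map; filter; reverse; upTo; [_])
open import Data.Nat.ListAction using (sum)
open import Data.Bool.ListAction using (any)
open import Data.List.Relation.Unary.All using (All)
open import Data.List.Relation.Unary.Linked using (Linked)
open import Data.Product using (_×_; ∃; ∃-syntax)
open import Relation.Unary using (Pred; _∪_; _∩_; _∖_; _≐_; Empty)
open import Relation.Binary.PropositionalEquality using (_≡_)
open import Relation.Nullary.Decidable using (does)

-- A partition is a list of parts, written in decreasing order.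
Partition : Set
Partition = List ℕ

PSet : Set₁
PSet = Pred Partition 0ℓ

IsPQ : ℕ → ℕ → ℕ → Set
IsPQ p q n = ∃[ a ] ∃[ b ] (n ≡ p ^ a * q ^ b)

ChainStep : ℕ → ℕ → Set
ChainStep x y = (y < x) × (y ∣ x)

StrictlyChained : ℕ → ℕ → Partition → Set
StrictlyChained p q λs = All (IsPQ p q) λs × Linked ChainStep λs

Ω : ℕ → ℕ → ℕ → PSet
Ω p q U λs = StrictlyChained p q λs × (sum λs ≡ U)

Img : (Partition → Partition) → PSet → PSet
Img f A λs = ∃[ μ ] (A μ × (λs ≡ f μ))

scale : ℕ → PSet → PSet
scale m A = Img (map (m *_)) A

isPow2 : ℕ → Bool
isPow2 n = any (λ i → (2 ^ i) ≡ᵇ n) (upTo (suc n))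

binUp : ℕ → ℕ → ℕ → List ℕ
binUp zero    n i = []
binUp (suc f) n i with n ≡ᵇ 0
... | true  = []
... | false = (if n % 2 ≡ᵇ 1 then (2 ^ i ∷ []) else []) ++ binUp f (n / 2) (suc i)

binExp : ℕ → List ℕ
binExp n = reverse (binUp n n 0)

-- the single-partition operation underlying ^1:
-- if min(p,q) = 2: replace the power-of-2 parts by the binary expansion of
--   (binary amount + 1);  otherwise append a part 1.
bump : ℕ → ℕ → Partition → Partition
bump p q μ = if (p ⊓ q) ≡ᵇ 2
  then filter (λ x → not (isPow2 x) Data.Bool.≟ true) μ ++ binExp (sum (filter (λ x → isPow2 x Data.Bool.≟ true) μ) + 1)
  else μ ++ [ 1 ]

one : ℕ → ℕ → PSet → PSet
one p q A = Img (bump p q) A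

_≋_⊎_ : PSet → PSet → PSet → Set
C ≋ A ⊎ B = Empty (A ∩ B) × (C ≐ (A ∪ B))

module Submission where

-- In a strictly chained partition each part divides the previous one, and a part
-- p^a q^b other than 1 is divisible by p or by q.  Hence every λ ∈ Ω(N) has one of
-- two shapes (`view`): either all parts are divisible by one base m ∈ {p, q}, so
-- λ = m·μ with μ ∈ Ω(c) and N = m·c ("Scaled"), or λ is such an m·μ followed by a
-- part 1, and N = m·c + 1 ("Bumped").  On partitions m·μ the operation ^1 simply
-- appends a part 1, also when min(p,q) = 2: the powers of 2 of a chain form a suffix,
-- which is the binary expansion of its own sum (`bump-snoc`).  Each identity of the
-- corollary is then a matter of residues of N = pqU + r modulo p and q: coprimality
-- and p·k₀ ≡ 1 (mod q), q·ℓ₀ ≡ 1 (mod p) decide which shapes occur, and with which c.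

open import Defs
open import Data.Nat
open import Data.Nat.Properties
open import Data.Nat.Divisibility
open import Data.Nat.Coprimality as Coprimality using (Coprime; coprime-divisor)
open import Data.Nat.Tactic.RingSolver using (solve-∀)
open import Data.Empty using (⊥-elim)
open import Data.Product using (_×_; _,_; ∃-syntax; proj₁; proj₂)
open import Data.Sum using (_⊎_; inj₁; inj₂; swap)
import Data.Sum
open import Relation.Binary.PropositionalEquality hiding ([_])
open import Relation.Nullary using (¬_; yes; no)
open import Relation.Unary using (_⊆_; _∪_; _∩_; _∖_; _≐_; Empty)
open import Function using (flip; _∘_; Equivalence)
open import Data.Bool using (true; false; not; if_then_else_)
open import Data.Bool.Properties using (T-≡)
import Data.Bool
open import Data.Nat.DivMod using (_/_; _%_; m*[n/m]≡n; [m+kn]%n≡m%n; m*n%n≡0; +-distrib-/-∣ʳ; m*n/n≡m)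
open import Data.Nat.ListAction using (sum)
open import Data.Nat.ListAction.Properties using (sum-↭; sum-++)
open import Data.List using (List; []; _∷_; _++_; map; [_]; upTo; reverse; foldl; filter)
open import Data.List.Properties using (∷-injective; ∷ʳ-injectiveˡ; map-∘; map-cong; map-id; reverse-map; reverse-involutive; filter-++; filter-all; filter-none; ++-identityʳ; ++-assoc)
open import Data.List.Membership.Propositional using (lose)
open import Data.List.Membership.Propositional.Properties using (∈-upTo⁺)
open import Data.List.Relation.Unary.All as All using (All; []; _∷_)
import Data.List.Relation.Unary.All.Properties as All
open import Data.List.Relation.Unary.Any using (satisfied)
open import Data.List.Relation.Unary.Any.Properties using (any⁺; any⁻)
open import Data.List.Relation.Unary.Linked as Linked using (Linked; []; [-]; _∷_)
import Data.List.Relation.Unary.Linked.Properties as Linked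
open import Data.List.Relation.Binary.Permutation.Propositional.Properties using (↭-reverse)

module Arithmetic where

  coprime-∤-pow : ∀ {a b} → 1 < a → Coprime a b → ∀ n → ¬ (a ∣ b ^ n)
  coprime-∤-pow 1<a cop zero    a∣1 = <⇒≢ 1<a (sym (∣1⇒≡1 a∣1))
  coprime-∤-pow 1<a cop (suc n) a∣b^n+1 = coprime-∤-pow 1<a cop n (coprime-divisor cop a∣b^n+1)

  multiple≢multiple+1 : ∀ {m} → 1 < m → ∀ x y → m * x ≢ m * y + 1
  multiple≢multiple+1 {m} 1<m x y eq = <⇒≢ 1<m (sym (∣1⇒≡1 m∣1))
    where
    m∣1 : m ∣ 1
    m∣1 = ∣m+n∣m⇒∣n (subst (m ∣_) eq (m∣m*n x)) (m∣m*n y)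

  multiple-below : ∀ {b n} → b ∣ n → n < b → n ≡ 0
  multiple-below {n = zero}  _   _   = refl
  multiple-below {n = suc n} b∣n n<b = ⊥-elim (<⇒≱ n<b (∣⇒≤ b∣n))

  multiple-between : ∀ {b n} → b ∣ n → 0 < n → n < b + b → n ≡ b
  multiple-between (divides zero          n≡0)  0<n _ = ⊥-elim (<⇒≢ 0<n (sym n≡0))
  multiple-between {b} (divides (suc zero) n≡b) _ _ = trans n≡b (+-identityʳ b)
  multiple-between {b} (divides (suc (suc d)) n≡) _ n<2b =
    ⊥-elim (<⇒≱ n<2b (subst (b + b ≤_) (sym n≡) (+-monoʳ-≤ b (m≤m+n b (d * b)))))

  offset-multiple : ∀ m x c r → m * x + r ≡ m * c → r ≡ (c ∸ x) * m
  offset-multiple m x c r eq = begin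
    r                  ≡⟨ sym (m+n∸m≡n (m * x) r) ⟩
    m * x + r ∸ m * x  ≡⟨ cong (_∸ m * x) eq ⟩
    m * c ∸ m * x      ≡⟨ sym (*-distribˡ-∸ m c x) ⟩
    m * (c ∸ x)        ≡⟨ *-comm m (c ∸ x) ⟩
    (c ∸ x) * m        ∎
    where open ≡-Reasoning

  coprime-residue : ∀ {a b} → Coprime b a → ∀ x y n → x * b ≡ y * b + n * a → b ∣ n
  coprime-residue {a} {b} cop x y n eq = coprime-divisor cop b∣a*n
    where
    b∣a*n : b ∣ a * n
    b∣a*n = subst (b ∣_) (*-comm n a) (∣m+n∣m⇒∣n (divides x (sym eq)) (divides y refl))

  residue-unique-≤ : ∀ {a b} → Coprime b a → ∀ x y {k k'} → k ≤ k' → k' < b →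
    x * b + k * a ≡ y * b + k' * a → k ≡ k'
  residue-unique-≤ {a} {b} cop x y {k} {k'} k≤k' k'<b eq =
    begin
      k           ≡⟨ sym (+-identityʳ k) ⟩
      k + 0       ≡⟨ cong (k +_) (sym d≡0) ⟩
      k + d       ≡⟨ m+[n∸m]≡n k≤k' ⟩
      k'          ∎
    where
    open ≡-Reasoning
    d = k' ∸ k
    shifted : x * b + k * a ≡ (y * b + d * a) + k * a
    shifted = trans eq (trans (cong (λ z → y * b + z * a) (sym (m+[n∸m]≡n k≤k'))) (regroup y b k d a))
      where
      regroup : ∀ y b k d a → y * b + (k + d) * a ≡ (y * b + d * a) + k * a
      regroup = solve-∀
    d≡0 : d ≡ 0
    d≡0 = multiple-below (coprime-residue cop x y d (+-cancelʳ-≡ (k * a) _ _ shifted))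
                         (≤-<-trans (m∸n≤m k' k) k'<b)

  residue-unique : ∀ {a b} → Coprime b a → ∀ x y {k k'} → k < b → k' < b →
    x * b + k * a ≡ y * b + k' * a → k ≡ k'
  residue-unique cop x y {k} {k'} k<b k'<b eq with ≤-total k k'
  ... | inj₁ k≤k' = residue-unique-≤ cop x y k≤k' k'<b eq
  ... | inj₂ k'≤k = sym (residue-unique-≤ cop y x k'≤k k<b (sym eq))

  -- If a·k₀ = t·b + 1 and b·ℓ₀ = s·a + 1 with k₀ < b and ℓ₀ < a, then t + ℓ₀ = a;
  -- that is, the cofactor t of the inverse k₀ of a mod b is a − ℓ₀.
  inverse-cofactor : ∀ {a b k₀ ℓ₀ t s} .{{_ : NonZero a}} → Coprime a b → k₀ < b → ℓ₀ < a →
    a * k₀ ≡ t * b + 1 → b * ℓ₀ ≡ s * a + 1 → t + ℓ₀ ≡ a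
  inverse-cofactor {a} {b} {k₀} {ℓ₀} {t} {s} cop k₀<b ℓ₀<a ak₀ bℓ₀ =
    multiple-between a∣t+ℓ₀ (≤-trans 0<ℓ₀ (m≤n+m ℓ₀ t)) (+-mono-< t<a ℓ₀<a)
    where
    same+1 : b * (t + ℓ₀) + 1 ≡ a * (k₀ + s) + 1
    same+1 = begin
      b * (t + ℓ₀) + 1       ≡⟨ regroupˡ b t ℓ₀ ⟩
      (t * b + 1) + b * ℓ₀   ≡⟨ cong₂ _+_ (sym ak₀) bℓ₀ ⟩
      a * k₀ + (s * a + 1)   ≡⟨ regroupʳ a k₀ s ⟩
      a * (k₀ + s) + 1       ∎
      where
      open ≡-Reasoning
      regroupˡ : ∀ b t ℓ₀ → b * (t + ℓ₀) + 1 ≡ (t * b + 1) + b * ℓ₀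
      regroupˡ = solve-∀
      regroupʳ : ∀ a k₀ s → a * k₀ + (s * a + 1) ≡ a * (k₀ + s) + 1
      regroupʳ = solve-∀
    a∣t+ℓ₀ : a ∣ t + ℓ₀
    a∣t+ℓ₀ = coprime-divisor cop (divides (k₀ + s) (trans (+-cancelʳ-≡ 1 _ _ same+1) (*-comm a (k₀ + s))))
    0<ℓ₀ : 0 < ℓ₀
    0<ℓ₀ = n≢0⇒n>0 λ ℓ₀≡0 →
      0≢1+n (trans (sym (*-zeroʳ b)) (trans (cong (b *_) (sym ℓ₀≡0)) (trans bℓ₀ (+-comm (s * a) 1))))
    t<a : t < a
    t<a = *-cancelʳ-< b t a (begin-strict
      t * b       <⟨ m<m+n (t * b) z<s ⟩
      t * b + 1   ≡⟨ sym ak₀ ⟩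
      a * k₀      <⟨ *-monoʳ-< a k₀<b ⟩
      a * b       ∎)
      where open ≤-Reasoning


module Lists where

  sum-map-* : ∀ m xs → sum (map (m *_) xs) ≡ m * sum xs
  sum-map-* m []       = sym (*-zeroʳ m)
  sum-map-* m (x ∷ xs) = trans (cong (m * x +_) (sum-map-* m xs)) (sym (*-distribˡ-+ m x (sum xs)))

  snoc1-chain : ∀ {μ} → Linked ChainStep μ → All (1 <_) μ → Linked ChainStep (μ ++ [ 1 ])
  snoc1-chain {[]}         _       _              = [-]
  snoc1-chain {x ∷ []}     _       (1<x ∷ [])    = (1<x , divides x (sym (*-identityʳ x))) ∷ [-]
  snoc1-chain {x ∷ y ∷ μ}  (c ∷ l) (_ ∷ 1<y∷μ)   = c ∷ snoc1-chain l 1<y∷μ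

  prefix-chain : ∀ {R : ℕ → ℕ → Set} μ {ν} → Linked R (μ ++ ν) → Linked R μ
  prefix-chain []          _       = []
  prefix-chain (x ∷ [])    _       = [-]
  prefix-chain (x ∷ y ∷ μ) (r ∷ l) = r ∷ prefix-chain (y ∷ μ) l

  suffix-chain : ∀ {R : ℕ → ℕ → Set} μ {ν} → Linked R (μ ++ ν) → Linked R ν
  suffix-chain []      l = l
  suffix-chain (x ∷ μ) l = suffix-chain μ (Linked.tail l)

  reverse⁺ : ∀ {R : ℕ → ℕ → Set} {xs} → Linked R xs → Linked (flip R) (reverse xs)
  reverse⁺ []        = []
  reverse⁺ {xs = x ∷ xs} l = onto x [] xs [-] l
    where
    -- Invariant: the accumulator acc, headed by x, is already a reversed chain.
    onto : ∀ {R : ℕ → ℕ → Set} x acc xs → Linked (flip R) (x ∷ acc) → Linked R (x ∷ xs) →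
      Linked (flip R) (foldl (flip _∷_) (x ∷ acc) xs)
    onto x acc []       la _       = la
    onto x acc (y ∷ xs) la (r ∷ l) = onto y (x ∷ acc) xs (r ∷ la) l


module Binary where
  open Lists

  Pow2 : ℕ → Set
  Pow2 n = isPow2 n ≡ true

  -- isPow2 n searches the exponents i ≤ n, which suffice since n < 2^n.
  n<2^n : ∀ n → n < 2 ^ n
  n<2^n zero    = z<s
  n<2^n (suc n) = subst (suc n <_) (sym (cong (2 ^ n +_) (+-identityʳ (2 ^ n))))
    (+-mono-≤ (m^n>0 2 n) (n<2^n n))

  Pow2⇒pow : ∀ {n} → Pow2 n → ∃[ i ] (n ≡ 2 ^ i)
  Pow2⇒pow {n} ok with satisfied (any⁻ _ (upTo (suc n)) (Equivalence.from T-≡ ok))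
  ... | i , 2^i≡n = i , sym (≡ᵇ⇒≡ (2 ^ i) n 2^i≡n)

  pow⇒Pow2 : ∀ i → Pow2 (2 ^ i)
  pow⇒Pow2 i = Equivalence.to T-≡ (any⁺ _ (lose (∈-upTo⁺ (s≤s (<⇒≤ (n<2^n i)))) (≡⇒≡ᵇ (2 ^ i) (2 ^ i) refl)))

  pow-cancel-< : ∀ {m n} → 2 ^ m < 2 ^ n → m < n
  pow-cancel-< lt = ≰⇒> λ n≤m → <⇒≱ lt (^-monoʳ-≤ 2 n≤m)

  pw : List ℕ → List ℕ
  pw = map (2 ^_)

  binUp-zero : ∀ f i → binUp f 0 i ≡ []
  binUp-zero zero    i = refl
  binUp-zero (suc f) i = refl

  binUp-odd : ∀ f i s → binUp (suc f) (suc (2 * s)) i ≡ 2 ^ i ∷ binUp f s (suc i)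
  binUp-odd f i s = cong₂ (λ r h → (if r ≡ᵇ 1 then (2 ^ i ∷ []) else []) ++ binUp f h (suc i)) rem quot
    where
    2s≡ : 2 * s ≡ s * 2
    2s≡ = *-comm 2 s
    rem : suc (2 * s) % 2 ≡ 1
    rem = trans (cong (λ n → suc n % 2) 2s≡) ([m+kn]%n≡m%n 1 s 2)
    quot : suc (2 * s) / 2 ≡ s
    quot = trans (cong (λ n → suc n / 2) 2s≡)
                 (trans (+-distrib-/-∣ʳ 1 {d = 2} (divides s refl)) (m*n/n≡m s 2))

  binUp-even : ∀ f i s → 0 < s → binUp (suc f) (2 * s) i ≡ binUp f s (suc i)
  binUp-even f i s@(suc _) _ = cong₂ (λ r h → (if r ≡ᵇ 1 then (2 ^ i ∷ []) else []) ++ binUp f h (suc i)) rem quot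
    where
    2s≡ : 2 * s ≡ s * 2
    2s≡ = *-comm 2 s
    rem : 2 * s % 2 ≡ 0
    rem = trans (cong (_% 2) 2s≡) (m*n%n≡0 s 2)
    quot : 2 * s / 2 ≡ s
    quot = trans (cong (_/ 2) 2s≡) (m*n/n≡m s 2)

  pw-suc : ∀ es → pw (map suc es) ≡ map (2 *_) (pw es)
  pw-suc es = trans (sym (map-∘ es)) (map-∘ es)

  shift-pw-suc : ∀ i es → map (2 ^ i *_) (pw (map suc es)) ≡ map (2 ^ suc i *_) (pw es)
  shift-pw-suc i es = begin
    map (2 ^ i *_) (pw (map suc es))       ≡⟨ cong (map (2 ^ i *_)) (pw-suc es) ⟩
    map (2 ^ i *_) (map (2 *_) (pw es))    ≡⟨ sym (map-∘ (pw es)) ⟩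
    map (λ x → 2 ^ i * (2 * x)) (pw es)    ≡⟨ map-cong (λ x → regroup (2 ^ i) x) (pw es) ⟩
    map (2 ^ suc i *_) (pw es)             ∎
    where
    open ≡-Reasoning
    regroup : ∀ a x → a * (2 * x) ≡ (2 * a) * x
    regroup = solve-∀

  lower : ∀ k ds → Linked _<_ (suc k ∷ ds) → ∃[ es ] (ds ≡ map suc es × Linked _<_ (k ∷ es))
  lower k []           _              = [] , refl , [-]
  lower k (suc d ∷ ds) (s≤s k<d ∷ l) with lower d ds l
  ... | es , refl , l' = d ∷ es , refl , k<d ∷ l'

  lower₀ : ∀ ds → Linked _<_ (0 ∷ ds) → ∃[ es ] (ds ≡ map suc es × Linked _<_ es)
  lower₀ []           _       = [] , refl , []
  lower₀ (suc d ∷ ds) (_ ∷ l) with lower d ds l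
  ... | es , refl , l' = d ∷ es , refl , l'

  binUp-pw : ∀ f ds i → Linked _<_ ds → sum (pw ds) ≤ f → binUp f (sum (pw ds)) i ≡ map (2 ^ i *_) (pw ds)
  binUp-pw f       []           i _ _  = binUp-zero f i
  binUp-pw zero    (d ∷ ds)     i _ le = ⊥-elim (<⇒≱ (≤-trans (m^n>0 2 d) (m≤m+n (2 ^ d) _)) le)
  binUp-pw (suc f) (zero ∷ ds)  i l le with lower₀ ds l
  ... | es , refl , les = begin
    binUp (suc f) (suc (sum (pw (map suc es)))) i  ≡⟨ cong (λ n → binUp (suc f) (suc n) i) double ⟩
    binUp (suc f) (suc (2 * s)) i                  ≡⟨ binUp-odd f i s ⟩
    2 ^ i ∷ binUp f s (suc i)                      ≡⟨ cong₂ _∷_ (sym (*-identityʳ (2 ^ i))) (binUp-pw f es (suc i) les fuel) ⟩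
    2 ^ i * 1 ∷ map (2 ^ suc i *_) (pw es)         ≡⟨ cong (2 ^ i * 1 ∷_) (sym (shift-pw-suc i es)) ⟩
    map (2 ^ i *_) (pw (zero ∷ map suc es))        ∎
    where
    open ≡-Reasoning
    s = sum (pw es)
    double : sum (pw (map suc es)) ≡ 2 * s
    double = trans (cong sum (pw-suc es)) (sum-map-* 2 (pw es))
    fuel : s ≤ f
    fuel = ≤-trans (m≤n*m s 2) (subst (_≤ f) double (s≤s⁻¹ le))
  binUp-pw (suc f) (suc d ∷ ds) i l le with lower d ds l
  ... | es' , refl , les = begin
    binUp (suc f) (sum (pw (map suc es))) i        ≡⟨ cong (λ n → binUp (suc f) n i) double ⟩
    binUp (suc f) (2 * s) i                        ≡⟨ binUp-even f i s 0<s ⟩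
    binUp f s (suc i)                              ≡⟨ binUp-pw f es (suc i) les fuel ⟩
    map (2 ^ suc i *_) (pw es)                     ≡⟨ sym (shift-pw-suc i es) ⟩
    map (2 ^ i *_) (pw (map suc es))               ∎
    where
    open ≡-Reasoning
    es = d ∷ es'
    s = sum (pw es)
    double : sum (pw (map suc es)) ≡ 2 * s
    double = trans (cong sum (pw-suc es)) (sum-map-* 2 (pw es))
    0<s : 0 < s
    0<s = ≤-trans (m^n>0 2 d) (m≤m+n (2 ^ d) _)
    fuel : s ≤ f
    fuel = s≤s⁻¹ (<-≤-trans (subst (s <_) (*-comm s 2) (m<m*n s 2 {{>-nonZero 0<s}} (s≤s (s≤s z≤n))))
                            (subst (_≤ suc f) double le))

  exponents : ∀ {C} → Linked _>_ C → All Pow2 C → ∃[ es ] (C ≡ pw es × Linked _>_ es)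
  exponents []            [] = [] , refl , []
  exponents {x ∷ C} l (px ∷ pC) with Pow2⇒pow {x} px | exponents (Linked.tail l) pC
  ... | e , refl | es , refl , les = e ∷ es , refl , linked es l les
    where
    linked : ∀ es → Linked _>_ (2 ^ e ∷ pw es) → Linked _>_ es → Linked _>_ (e ∷ es)
    linked []       _       _   = [-]
    linked (_ ∷ _)  (r ∷ _) les = pow-cancel-< r ∷ les

  binExp-sum : ∀ {C} → Linked _>_ C → All Pow2 C → binExp (sum C) ≡ C
  binExp-sum l pC with exponents l pC
  ... | es , refl , les = begin
    reverse (binUp S S 0)                 ≡⟨ cong (λ n → reverse (binUp n n 0)) S≡S' ⟩
    reverse (binUp S' S' 0)               ≡⟨ cong reverse (binUp-pw S' (reverse es) 0 (reverse⁺ les) ≤-refl) ⟩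
    reverse (map (1 *_) (pw (reverse es)))  ≡⟨ cong reverse (trans (map-cong *-identityˡ (pw (reverse es))) (map-id (pw (reverse es)))) ⟩
    reverse (pw (reverse es))             ≡⟨ cong reverse (reverse-map (2 ^_) es) ⟩
    reverse (reverse (pw es))             ≡⟨ reverse-involutive (pw es) ⟩
    pw es                                 ∎
    where
    open ≡-Reasoning
    S  = sum (pw es)
    S' = sum (pw (reverse es))
    S≡S' : S ≡ S'
    S≡S' = trans (sym (sum-↭ (↭-reverse (pw es)))) (cong sum (sym (reverse-map (2 ^_) es)))


module PQNumbers where
  open Arithmetic

  IsPQ-swap : ∀ {a b n} → IsPQ a b n → IsPQ b a n
  IsPQ-swap {a} {b} (i , j , e) = j , i , trans e (*-comm (a ^ i) (b ^ j))

  pq-1 : ∀ {a b} → IsPQ a b 1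
  pq-1 = 0 , 0 , refl

  pq-pos : ∀ {a b n} .{{_ : NonZero a}} .{{_ : NonZero b}} → IsPQ a b n → 0 < n
  pq-pos {a} {b} (i , j , refl) = >-nonZero⁻¹ _ {{m*n≢0 (a ^ i) (b ^ j) {{m^n≢0 a i}} {{m^n≢0 b j}}}}

  pq-mulˡ : ∀ {a b n} → IsPQ a b n → IsPQ a b (a * n)
  pq-mulˡ {a} {b} (i , j , e) = suc i , j , trans (cong (a *_) e) (sym (*-assoc a (a ^ i) (b ^ j)))

  pq-divˡ : ∀ {a b n} → 1 < a → Coprime a b → IsPQ a b (a * n) → IsPQ a b n
  pq-divˡ {a} {b} {n} 1<a cop (suc i , j , e) =
    i , j , *-cancelˡ-≡ n _ a {{>-nonZero (<-trans z<s 1<a)}} (trans e (*-assoc a (a ^ i) (b ^ j)))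
  pq-divˡ {a} {b} {n} 1<a cop (zero , j , e) =
    ⊥-elim (coprime-∤-pow 1<a cop j (divides n (trans (sym (+-identityʳ (b ^ j))) (trans (sym e) (*-comm a n)))))


-- Numbers 2^a o^b for an odd o > 1: the situation of ^1 when min(p,q) = 2.
module PowersOfTwo (o : ℕ) (1<o : 1 < o) (cop : Coprime o 2) where
  open Arithmetic
  open Lists
  open Binary

  -- A divisor 2^c o^d of a power of 2 is a power of 2, since o ∤ 2^i.
  divisor-pow2 : ∀ {y i} → IsPQ 2 o y → y ∣ 2 ^ i → Pow2 y
  divisor-pow2 (c , zero , refl) _ = subst Pow2 (sym (*-identityʳ (2 ^ c))) (pow⇒Pow2 c)
  divisor-pow2 {i = i} (c , suc d , refl) y∣2^i = ⊥-elim (coprime-∤-pow 1<o cop i (∣-trans o∣y y∣2^i))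
    where
    o∣y : o ∣ 2 ^ c * (o * o ^ d)
    o∣y = divides (2 ^ c * o ^ d) (regroup (2 ^ c) o (o ^ d))
      where
      regroup : ∀ x o y → x * (o * y) ≡ (x * y) * o
      regroup = solve-∀

  pow2-suffix : ∀ {μ} → Linked ChainStep μ → All (IsPQ 2 o) μ →
    ∃[ A ] ∃[ B ] (μ ≡ A ++ B × All (λ x → ¬ Pow2 x) A × All Pow2 B)
  pow2-suffix [] [] = [] , [] , refl , [] , []
  pow2-suffix {x ∷ μ} l (_ ∷ dμ) with pow2-suffix (Linked.tail l) dμ | isPow2 x in isPow2x
  ... | A , B , refl , nA , pB | false = x ∷ A , B , refl , (λ t → false≢true (trans (sym isPow2x) t)) ∷ nA , pB
    where
    false≢true : false ≢ true
    false≢true ()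
  ... | [] , B , refl , [] , pB | true = [] , x ∷ B , refl , [] , isPow2x ∷ pB
  ... | y ∷ A , B , refl , ¬pow2y ∷ nA , pB | true with Pow2⇒pow {x} isPow2x
  ...   | i , x≡2^i = ⊥-elim (¬pow2y (divisor-pow2 {i = i} (All.head dμ) (subst (y ∣_) x≡2^i (proj₂ (Linked.head l)))))

  bump-dyadic : ∀ {μ} → Linked ChainStep μ → All (IsPQ 2 o) μ → All (1 <_) μ →
    filter (λ x → not (isPow2 x) Data.Bool.≟ true) μ ++ binExp (sum (filter (λ x → isPow2 x Data.Bool.≟ true) μ) + 1)
      ≡ μ ++ [ 1 ]
  bump-dyadic {μ} l dμ 1<μ with pow2-suffix l dμ
  ... | A , B , refl , nA , pB = begin
    filter F₁ (A ++ B) ++ binExp (sum (filter F₂ (A ++ B)) + 1)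
      ≡⟨ cong₂ (λ X Y → X ++ binExp (sum Y + 1)) (filter-++ F₁ A B) (filter-++ F₂ A B) ⟩
    (filter F₁ A ++ filter F₁ B) ++ binExp (sum (filter F₂ A ++ filter F₂ B) + 1)
      ≡⟨ cong₂ (λ X Y → X ++ binExp (sum Y + 1))
           (cong₂ _++_ (filter-all F₁ (All.map (λ {x} → ¬Pow2⇒not {x}) nA)) (filter-none F₁ (All.map (λ {x} → Pow2⇒¬not {x}) pB)))
           (cong₂ _++_ (filter-none F₂ nA) (filter-all F₂ pB)) ⟩
    (A ++ []) ++ binExp (sum B + 1)      ≡⟨ cong₂ _++_ (++-identityʳ A) (cong binExp (sym (sum-++ B [ 1 ]))) ⟩
    A ++ binExp (sum (B ++ [ 1 ]))       ≡⟨ cong (A ++_) (binExp-sum (Linked.map proj₁ chainB1) (All.++⁺ pB (pow⇒Pow2 0 ∷ []))) ⟩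
    A ++ (B ++ [ 1 ])                    ≡⟨ sym (++-assoc A B [ 1 ]) ⟩
    (A ++ B) ++ [ 1 ]                    ∎
    where
    open ≡-Reasoning
    F₁ = λ x → not (isPow2 x) Data.Bool.≟ true
    F₂ = λ x → isPow2 x Data.Bool.≟ true
    ¬Pow2⇒not : ∀ {x} → ¬ Pow2 x → not (isPow2 x) ≡ true
    ¬Pow2⇒not {x} ¬pow2 with isPow2 x
    ... | true  = ⊥-elim (¬pow2 refl)
    ... | false = refl
    Pow2⇒¬not : ∀ {x} → Pow2 x → ¬ (not (isPow2 x) ≡ true)
    Pow2⇒¬not pow2 t with trans (sym (cong not pow2)) t
    ... | ()
    chainB1 : Linked ChainStep (B ++ [ 1 ])
    chainB1 = suffix-chain A (subst (Linked ChainStep) (++-assoc A B [ 1 ]) (snoc1-chain l 1<μ))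


module Chains (p q : ℕ) (1<p : 1 < p) (1<q : 1 < q) (cop : Coprime p q) where
  open Arithmetic
  open Lists
  open PQNumbers

  SC : Partition → Set
  SC = StrictlyChained p q

  Side : ℕ → Set
  Side m = m ≡ p ⊎ m ≡ q

  1<side : ∀ {m} → Side m → 1 < m
  1<side (inj₁ refl) = 1<p
  1<side (inj₂ refl) = 1<q

  side≢0 : ∀ {m} → Side m → NonZero m
  side≢0 s = >-nonZero (<-trans z<s (1<side s))

  instance
    p≢0 : NonZero p
    p≢0 = side≢0 (inj₁ refl)
    q≢0 : NonZero q
    q≢0 = side≢0 (inj₂ refl)

  pq-mul : ∀ {m n} → Side m → IsPQ p q n → IsPQ p q (m * n)
  pq-mul (inj₁ refl) h = pq-mulˡ h
  pq-mul (inj₂ refl) h = IsPQ-swap (pq-mulˡ (IsPQ-swap h))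

  pq-div : ∀ {m n} → Side m → IsPQ p q (m * n) → IsPQ p q n
  pq-div (inj₁ refl) h = pq-divˡ 1<p cop h
  pq-div (inj₂ refl) h = IsPQ-swap (pq-divˡ 1<q (Coprimality.sym cop) (IsPQ-swap h))

  pq-split : ∀ {x} → IsPQ p q x → x ≡ 1 ⊎ ∃[ m ] (Side m × m ∣ x)
  pq-split (zero  , zero  , e) = inj₁ e
  pq-split (suc a , b     , e) = inj₂ (p , inj₁ refl , divides (p ^ a * q ^ b)
    (trans e (trans (*-assoc p (p ^ a) (q ^ b)) (*-comm p _))))
  pq-split (zero  , suc b , e) = inj₂ (q , inj₂ refl , divides (q ^ b)
    (trans e (trans (+-identityʳ (q * q ^ b)) (*-comm q _))))

  parts>1 : ∀ {m λs} → Side m → All (IsPQ p q) λs → All (m ∣_) λs → All (1 <_) λs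
  parts>1 s []       []         = []
  parts>1 s (h ∷ hs) (m∣x ∷ ds) = <-≤-trans (1<side s) (∣⇒≤ {{>-nonZero (pq-pos h)}} m∣x) ∷ parts>1 s hs ds

  scaled-SC : ∀ {m μ} → Side m → SC μ → SC (map (m *_) μ)
  scaled-SC {m} s (hs , l) = All.map⁺ (All.map (pq-mul s) hs) , Linked.map⁺ (Linked.map step l)
    where
    step : ∀ {x y} → ChainStep x y → ChainStep (m * x) (m * y)
    step (y<x , y∣x) = *-monoʳ-< m {{side≢0 s}} y<x , *-monoʳ-∣ m y∣x

  unscaled-SC : ∀ {m} μ → Side m → SC (map (m *_) μ) → SC μ
  unscaled-SC {m} μ s (hs , l) = All.map (pq-div s) (All.map⁻ hs) , Linked.map step (Linked.map⁻ l)
    where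
    step : ∀ {x y} → ChainStep (m * x) (m * y) → ChainStep x y
    step {x} {y} (my<mx , my∣mx) = *-cancelˡ-< m y x my<mx , *-cancelˡ-∣ m {{side≢0 s}} my∣mx

  scale⇒∣ : ∀ {m A λs} → scale m A λs → All (m ∣_) λs
  scale⇒∣ {m} (μ , _ , refl) = All.map⁺ (All.universal (λ x → m∣m*n x) μ)

  scale⊆Ω : ∀ {m n} → Side m → scale m (Ω p q n) ⊆ Ω p q (m * n)
  scale⊆Ω {m} s (μ , (sc , sum≡n) , refl) = scaled-SC s sc , trans (sum-map-* m μ) (cong (m *_) sum≡n)

  Scaled : ℕ → ℕ → PSet
  Scaled m N λs = ∃[ c ] (N ≡ m * c × scale m (Ω p q c) λs)

  Bumped : ℕ → ℕ → PSet
  Bumped m N λs = ∃[ c ] (N ≡ m * c + 1 × one p q (scale m (Ω p q c)) λs)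

  multiples⇒Scaled : ∀ {m N λs} → Side m → Ω p q N λs → All (m ∣_) λs → Scaled m N λs
  multiples⇒Scaled {m} {N} {λs} s (sc , sum≡N) m∣λs =
    sum μ , N≡ , μ , (unscaled-SC μ s (subst SC λs≡ sc) , refl) , λs≡
    where
    instance _ = side≢0 s
    μ = map (_/ m) λs
    λs≡ : λs ≡ map (m *_) μ
    λs≡ = unmap m∣λs
      where
      unmap : ∀ {xs} → All (m ∣_) xs → xs ≡ map (m *_) (map (_/ m) xs)
      unmap []         = refl
      unmap (d ∷ ds)   = cong₂ _∷_ (sym (m*[n/m]≡n d)) (unmap ds)
    N≡ : N ≡ m * sum μ
    N≡ = trans (sym sum≡N) (trans (cong sum λs≡) (sum-map-* m μ))

  snoc1-SC : ∀ {μ} → SC μ → All (1 <_) μ → SC (μ ++ [ 1 ])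
  snoc1-SC (hs , l) 1<μ = All.++⁺ hs (pq-1 ∷ []) , snoc1-chain l 1<μ

  unsnoc-SC : ∀ μ {ν} → SC (μ ++ ν) → SC μ
  unsnoc-SC μ (hs , l) = All.++⁻ˡ μ hs , prefix-chain μ l

  if-else : ∀ {A : Set} b {x y : A} → (b ≡ true → x ≡ y) → (if b then x else y) ≡ y
  if-else true  x≡y = x≡y refl
  if-else false _   = refl

  -- ^1 acts on a strictly chained partition with all parts > 1 by appending a part 1.
  -- (If min(p,q) = 2 the other base o is odd and PowersOfTwo applies.)
  bump-snoc : ∀ {μ} → SC μ → All (1 <_) μ → bump p q μ ≡ μ ++ [ 1 ]
  bump-snoc {μ} (hs , l) 1<μ = if-else ((p ⊓ q) ≡ᵇ 2) binary
    where
    binary : ((p ⊓ q) ≡ᵇ 2) ≡ true →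
      filter (λ x → not (isPow2 x) Data.Bool.≟ true) μ ++ binExp (sum (filter (λ x → isPow2 x Data.Bool.≟ true) μ) + 1)
        ≡ μ ++ [ 1 ]
    binary min≡ᵇ2 with ⊓-sel p q
    ... | inj₁ min≡p = PowersOfTwo.bump-dyadic q 1<q (subst (Coprime q) p≡2 (Coprimality.sym cop)) l
                         (All.map (subst (λ b → IsPQ b q _) p≡2) hs) 1<μ
      where
      p≡2 : p ≡ 2
      p≡2 = trans (sym min≡p) (≡ᵇ⇒≡ _ 2 (Equivalence.from T-≡ min≡ᵇ2))
    ... | inj₂ min≡q = PowersOfTwo.bump-dyadic p 1<p (subst (Coprime p) q≡2 cop) l
                         (All.map (λ h → subst (λ b → IsPQ b p _) q≡2 (IsPQ-swap h)) hs) 1<μ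
      where
      q≡2 : q ≡ 2
      q≡2 = trans (sym min≡q) (≡ᵇ⇒≡ _ 2 (Equivalence.from T-≡ min≡ᵇ2))

  AppendsOne : PSet → Set
  AppendsOne A = ∀ {μ} → A μ → bump p q μ ≡ μ ++ [ 1 ]

  scale-AppendsOne : ∀ {m n} → Side m → AppendsOne (scale m (Ω p q n))
  scale-AppendsOne s h with scale⊆Ω s h
  ... | sc , _ = bump-snoc sc (parts>1 s (proj₁ sc) (scale⇒∣ h))

  one-intro : ∀ {A μ} → AppendsOne A → A μ → one p q A (μ ++ [ 1 ])
  one-intro appends h = _ , h , sym (appends h)

  one-elim : ∀ {A λs} → AppendsOne A → one p q A λs → ∃[ μ ] (λs ≡ μ ++ [ 1 ] × A μ)
  one-elim appends (μ , h , refl) = μ , appends h , h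

  one⊆Ω : ∀ {m n} → Side m → one p q (scale m (Ω p q n)) ⊆ Ω p q (m * n + 1)
  one⊆Ω s h with one-elim (scale-AppendsOne s) h
  ... | μ , refl , hμ with scale⊆Ω s hμ
  ...   | sc , sum≡ = snoc1-SC sc (parts>1 s (proj₁ sc) (scale⇒∣ hμ)) , trans (sum-++ μ [ 1 ]) (cong (_+ 1) sum≡)

  -- Shape of a strictly chained partition: all its parts are divisible by one base m,
  -- possibly except for a final part 1.  (Every part divides the previous one, and
  -- a part p^a q^b other than 1 is divisible by p or q.)
  data Shape (λs : Partition) : Set where
    multiples   : ∀ {m} → Side m → All (m ∣_) λs → Shape λs
    multiples+1 : ∀ {m} μ → Side m → All (m ∣_) μ → λs ≡ μ ++ [ 1 ] → Shape λs

  shape : ∀ {λs} → SC λs → Shape λs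
  shape {[]} _ = multiples (inj₁ refl) []
  shape {x ∷ []} (h ∷ [] , _) with pq-split h
  ... | inj₁ refl          = multiples+1 [] (inj₁ refl) [] refl
  ... | inj₂ (m , s , m∣x) = multiples s (m∣x ∷ [])
  shape {x ∷ y ∷ λs} (h ∷ hs , c ∷ l) with shape (hs , l)
  ... | multiples s (m∣y ∷ ds) = multiples s (∣-trans m∣y (proj₂ c) ∷ m∣y ∷ ds)
  ... | multiples+1 (z ∷ μ) s (m∣z ∷ ds) eq with ∷-injective eq
  ...   | refl , _ = multiples+1 (x ∷ z ∷ μ) s (∣-trans m∣z (proj₂ c) ∷ m∣z ∷ ds) (cong (x ∷_) eq)
  shape {x ∷ y ∷ λs} (h ∷ hs , c ∷ l) | multiples+1 [] _ [] refl with pq-split h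
  ...   | inj₁ refl           = ⊥-elim (<-irrefl refl (proj₁ c))
  ...   | inj₂ (m , s , m∣x)  = multiples+1 (x ∷ []) s (m∣x ∷ []) refl

  Near : ℕ → ℕ → PSet
  Near m N = Scaled m N ∪ Bumped m N

  near : ∀ {N λs} → Ω p q N λs → ∃[ m ] (Side m × Near m N λs)
  near h@(sc , _) with shape sc
  ... | multiples s ds = _ , s , inj₁ (multiples⇒Scaled s h ds)
  near {N} h@(sc , sum≡N) | multiples+1 {m} μ s ds refl with multiples⇒Scaled s (unsnoc-SC μ sc , refl) ds
  ... | c , sumμ≡ , hμ = m , s , inj₂ (c , N≡ , one-intro (scale-AppendsOne s) hμ)
    where
    N≡ : N ≡ m * c + 1
    N≡ = trans (sym sum≡N) (trans (sum-++ μ [ 1 ]) (cong (_+ 1) sumμ≡))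

  view : ∀ {N λs} → Ω p q N λs → Near p N λs ⊎ Near q N λs
  view h with near h
  ... | _ , inj₁ refl , n = inj₁ n
  ... | _ , inj₂ refl , n = inj₂ n

  scaled-in : ∀ {m n N} → Side m → N ≡ m * n → scale m (Ω p q n) ⊆ Ω p q N
  scaled-in s refl h = scale⊆Ω s h

  bumped-in : ∀ {m n N} → Side m → N ≡ m * n + 1 → one p q (scale m (Ω p q n)) ⊆ Ω p q N
  bumped-in s refl h = one⊆Ω s h

  scaled-at : ∀ {m n N λs} → Side m → N ≡ m * n → Scaled m N λs → scale m (Ω p q n) λs
  scaled-at {m} {n} {λs = λs} s N≡ (c , N≡' , h) =
    subst (λ c → scale m (Ω p q c) λs) (*-cancelˡ-≡ c n m {{side≢0 s}} (trans (sym N≡') N≡)) h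

  bumped-at : ∀ {m n N λs} → Side m → N ≡ m * n + 1 → Bumped m N λs → one p q (scale m (Ω p q n)) λs
  bumped-at {m} {n} {λs = λs} s N≡ (c , N≡' , h) =
    subst (λ c → one p q (scale m (Ω p q c)) λs)
          (*-cancelˡ-≡ c n m {{side≢0 s}} (+-cancelʳ-≡ 1 _ _ (trans (sym N≡') N≡))) h

  scaled-off : ∀ {m n N λs} → Side m → N ≡ m * n + 1 → ¬ Scaled m N λs
  scaled-off {n = n} s N≡ (c , N≡' , _) = multiple≢multiple+1 (1<side s) c n (trans (sym N≡') N≡)

  bumped-off : ∀ {m n N λs} → Side m → N ≡ m * n → ¬ Bumped m N λs
  bumped-off {n = n} s N≡ (c , N≡' , _) = multiple≢multiple+1 (1<side s) n c (trans (sym N≡) N≡')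

  scale∩one : ∀ {m m' n A} → Side m → Side m' → Empty (scale m A ∩ one p q (scale m' (Ω p q n)))
  scale∩one s s' λs (h , h') with one-elim (scale-AppendsOne s') h'
  ... | μ , refl , _ with All.++⁻ʳ μ (scale⇒∣ h)
  ...   | m∣1 ∷ [] = <⇒≢ (1<side s) (sym (∣1⇒≡1 m∣1))

  Rest : ℕ → PSet
  Rest U = scale q (Ω p q (p * U) ∖ scale p (Ω p q U))

  Rest⊆ : ∀ {U} → Rest U ⊆ scale q (Ω p q (p * U))
  Rest⊆ (ν , (hν , _) , e) = ν , hν , e

  -- As p ∤ q, the parts of q·ν are all divisible by p iff those of ν are.
  q·-multiples⁻ : ∀ ν → All (p ∣_) (map (q *_) ν) → All (p ∣_) ν
  q·-multiples⁻ ν ds = All.map (coprime-divisor cop) (All.map⁻ ds)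

  q·-multiples⁺ : ∀ ν → All (p ∣_) ν → All (p ∣_) (map (q *_) ν)
  q·-multiples⁺ ν ds = All.map⁺ (All.map (∣n⇒∣m*n q) ds)

  pqU≡p· : ∀ U → p * q * U ≡ p * (q * U)
  pqU≡p· U = *-assoc p q U

  pqU≡q· : ∀ U → p * q * U ≡ q * (p * U)
  pqU≡q· U = regroup p q U
    where
    regroup : ∀ p q U → p * q * U ≡ q * (p * U)
    regroup = solve-∀

  -- Ω(pqU) = p·Ω(qU) + q·(Ω(pU) ∖ p·Ω(U)): the partitions of pqU are the p·μ and q·ν,
  -- and q·ν is some p·μ exactly when ν is.
  clause-pqU : ∀ U → Ω p q (p * q * U) ≋ scale p (Ω p q (q * U)) ⊎ Rest U
  clause-pqU U = disjoint , sub , sup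
    where
    P : Side p
    P = inj₁ refl
    Q : Side q
    Q = inj₂ refl
    disjoint : Empty (scale p (Ω p q (q * U)) ∩ Rest U)
    disjoint _ (h , ν , (hν , ν∉p·) , refl) =
      ν∉p· (scaled-at P refl (multiples⇒Scaled P hν (q·-multiples⁻ ν (scale⇒∣ h))))
    q·-split : ∀ {λs} → Ω p q (p * q * U) λs → scale q (Ω p q (p * U)) λs → (scale p (Ω p q (q * U)) ∪ Rest U) λs
    q·-split {λs} h (ν , hν , refl) with All.all? (p ∣?_) λs
    ... | yes ds = inj₁ (scaled-at P (pqU≡p· U) (multiples⇒Scaled P h ds))
    ... | no ¬ds = inj₂ (ν , (hν , λ hν' → ¬ds (q·-multiples⁺ ν (scale⇒∣ hν'))) , refl)
    sub : Ω p q (p * q * U) ⊆ scale p (Ω p q (q * U)) ∪ Rest U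
    sub h with view h
    ... | inj₁ (inj₁ sc) = inj₁ (scaled-at P (pqU≡p· U) sc)
    ... | inj₁ (inj₂ bu) = ⊥-elim (bumped-off P (pqU≡p· U) bu)
    ... | inj₂ (inj₁ sc) = q·-split h (scaled-at Q (pqU≡q· U) sc)
    ... | inj₂ (inj₂ bu) = ⊥-elim (bumped-off Q (pqU≡q· U) bu)
    sup : scale p (Ω p q (q * U)) ∪ Rest U ⊆ Ω p q (p * q * U)
    sup (inj₁ h) = scaled-in P (pqU≡p· U) h
    sup (inj₂ h) = scaled-in Q (pqU≡q· U) (Rest⊆ h)

  -- Ω(pqU + 1) = ^1 of the two pieces above: a partition of pqU + 1 is a partition
  -- of pqU (necessarily made of multiples of p or q) with a part 1 appended.
  clause-pqU+1 : ∀ U → Ω p q (p * q * U + 1) ≋ one p q (scale p (Ω p q (q * U))) ⊎ one p q (Rest U)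
  clause-pqU+1 U = disjoint , sub , sup
    where
    P : Side p
    P = inj₁ refl
    Q : Side q
    Q = inj₂ refl
    appendsP : AppendsOne (scale p (Ω p q (q * U)))
    appendsP = scale-AppendsOne P
    appendsRest : AppendsOne (Rest U)
    appendsRest h = scale-AppendsOne Q (Rest⊆ h)
    disjoint : Empty (one p q (scale p (Ω p q (q * U))) ∩ one p q (Rest U))
    disjoint _ (h , h') with one-elim appendsP h | one-elim appendsRest h'
    ... | μ , refl , hμ | μ' , e , hμ' with ∷ʳ-injectiveˡ μ μ' e
    ...   | refl = proj₁ (clause-pqU U) μ (hμ , hμ')
    sub : Ω p q (p * q * U + 1) ⊆ one p q (scale p (Ω p q (q * U))) ∪ one p q (Rest U)
    sub h with view h
    ... | inj₁ (inj₁ sc) = ⊥-elim (scaled-off P (cong (_+ 1) (pqU≡p· U)) sc)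
    ... | inj₁ (inj₂ bu) = inj₁ (bumped-at P (cong (_+ 1) (pqU≡p· U)) bu)
    ... | inj₂ (inj₁ sc) = ⊥-elim (scaled-off Q (cong (_+ 1) (pqU≡q· U)) sc)
    ... | inj₂ (inj₂ bu) with one-elim (scale-AppendsOne Q) (bumped-at Q (cong (_+ 1) (pqU≡q· U)) bu)
    ...   | μ , refl , hμ with proj₁ (proj₂ (clause-pqU U)) (scaled-in Q (pqU≡q· U) hμ)
    ...     | inj₁ hp = inj₁ (one-intro appendsP hp)
    ...     | inj₂ hr = inj₂ (one-intro appendsRest hr)
    sup : one p q (scale p (Ω p q (q * U))) ∪ one p q (Rest U) ⊆ Ω p q (p * q * U + 1)
    sup (inj₁ h) = bumped-in P (cong (_+ 1) (pqU≡p· U)) h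
    sup (inj₂ h) with one-elim appendsRest h
    ... | μ , refl , hr = bumped-in Q (cong (_+ 1) (pqU≡q· U)) (one-intro (scale-AppendsOne Q) (Rest⊆ hr))

  -- Residue analysis of N = pqU + r, 1 < r < pq, for an ordering (a, b) of the bases
  -- (so that each of the clauses below serves twice).  Here a·k₀ = t₀·b + 1 and
  -- b·ℓ₀ = s₀·a + 1, i.e. k₀ = a⁻¹ mod b and ℓ₀ = b⁻¹ mod a; view-ab is the view of
  -- partitions with the bases in this order.
  module Residues (a b : ℕ) (sa : Side a) (sb : Side b) (cab : Coprime a b)
                  (view-ab : ∀ {N λs} → Ω p q N λs → Near a N λs ⊎ Near b N λs)
                  (ab≡pq : a * b ≡ p * q)
                  (k₀ ℓ₀ t₀ s₀ : ℕ) (k₀<b : k₀ < b) (ak₀ : a * k₀ ≡ t₀ * b + 1)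
                  (ℓ₀<a : ℓ₀ < a) (bℓ₀ : b * ℓ₀ ≡ s₀ * a + 1) (U : ℕ) where

    instance
      a≢0 : NonZero a
      a≢0 = side≢0 sa

    cba : Coprime b a
    cba = Coprimality.sym cab

    N : ℕ → ℕ
    N r = p * q * U + r

    N≡ : ∀ r → N r ≡ a * (b * U) + r
    N≡ r = trans (cong (λ x → x * U + r) (sym ab≡pq)) (cong (_+ r) (*-assoc a b U))

    N-ka : ∀ k → N (k * a) ≡ a * (b * U + k)
    N-ka k = trans (N≡ (k * a)) (trans (cong (a * (b * U) +_) (*-comm k a)) (sym (*-distribˡ-+ a (b * U) k)))

    N-ka+1 : ∀ k → N (k * a + 1) ≡ a * (b * U + k) + 1
    N-ka+1 k = trans (sym (+-assoc (p * q * U) (k * a) 1)) (cong (_+ 1) (N-ka k))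

    a∸ℓ₀≡t₀ : a ∸ ℓ₀ ≡ t₀
    a∸ℓ₀≡t₀ = trans (cong (_∸ ℓ₀) (sym (inverse-cofactor {t = t₀} {s = s₀} cab k₀<b ℓ₀<a ak₀ bℓ₀))) (m+n∸n≡m t₀ ℓ₀)

    b∸k₀≡s₀ : b ∸ k₀ ≡ s₀
    b∸k₀≡s₀ = trans (cong (_∸ k₀) (sym (inverse-cofactor {t = s₀} {s = t₀} {{side≢0 sb}} cba ℓ₀<a k₀<b bℓ₀ ak₀))) (m+n∸n≡m s₀ k₀)

    multiplier<b : ∀ {k r} → k * a ≤ r → r < p * q → k < b
    multiplier<b {k} {r} ka≤r r<pq = *-cancelʳ-< a k b (≤-<-trans ka≤r (subst (r <_) (trans (sym ab≡pq) (*-comm a b)) r<pq))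

    0<multiplier : ∀ k → 1 < k * a → 0 < k
    0<multiplier (suc _) _ = z<s

    0<multiplier+1 : ∀ k → 1 < k * a + 1 → 0 < k
    0<multiplier+1 zero    (s≤s ())
    0<multiplier+1 (suc _) _ = z<s

    ka≢b· : ∀ {k c} → 0 < k → k < b → N (k * a) ≢ b * c
    ka≢b· {k} {c} 0<k k<b eq = <⇒≢ 0<k (sym (multiple-below (coprime-residue cba c (a * U) k c·b≡) k<b))
      where
      c·b≡ : c * b ≡ a * U * b + k * a
      c·b≡ = trans (*-comm c b) (trans (sym eq) (trans (N≡ (k * a)) (regroup a b U (k * a))))
        where
        regroup : ∀ a b U x → a * (b * U) + x ≡ a * U * b + x
        regroup = solve-∀

    ka≡b·+1 : ∀ {k c} → k < b → N (k * a) ≡ b * c + 1 → k ≡ k₀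
    ka≡b·+1 {k} {c} k<b eq = sym (residue-unique cba c (a * U + t₀) k₀<b k<b c·b+k₀a≡)
      where
      c·b+k₀a≡ : c * b + k₀ * a ≡ (a * U + t₀) * b + k * a
      c·b+k₀a≡ = begin
        c * b + k₀ * a              ≡⟨ cong (c * b +_) (trans (*-comm k₀ a) ak₀) ⟩
        c * b + (t₀ * b + 1)        ≡⟨ regroupˡ c b t₀ ⟩
        t₀ * b + (b * c + 1)        ≡⟨ cong (t₀ * b +_) (sym eq) ⟩
        t₀ * b + N (k * a)          ≡⟨ cong (t₀ * b +_) (N≡ (k * a)) ⟩
        t₀ * b + (a * (b * U) + k * a) ≡⟨ regroupʳ a b U k t₀ ⟩
        (a * U + t₀) * b + k * a    ∎
        where
        open ≡-Reasoning
        regroupˡ : ∀ c b t → c * b + (t * b + 1) ≡ t * b + (b * c + 1)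
        regroupˡ = solve-∀
        regroupʳ : ∀ a b U k t → t * b + (a * (b * U) + k * a) ≡ (a * U + t) * b + k * a
        regroupʳ = solve-∀

    k₀a≡b·+1 : N (k₀ * a) ≡ b * (a * U + (a ∸ ℓ₀)) + 1
    k₀a≡b·+1 = begin
      N (k₀ * a)                       ≡⟨ N≡ (k₀ * a) ⟩
      a * (b * U) + k₀ * a             ≡⟨ cong (a * (b * U) +_) (trans (*-comm k₀ a) ak₀) ⟩
      a * (b * U) + (t₀ * b + 1)       ≡⟨ regroup a b U t₀ ⟩
      b * (a * U + t₀) + 1             ≡⟨ cong (λ x → b * (a * U + x) + 1) (sym a∸ℓ₀≡t₀) ⟩
      b * (a * U + (a ∸ ℓ₀)) + 1       ∎
      where
      open ≡-Reasoning
      regroup : ∀ a b U t → a * (b * U) + (t * b + 1) ≡ b * (a * U + t) + 1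
      regroup = solve-∀

    ka+1≡b· : ∀ {k c} → 0 < k → k < b → N (k * a + 1) ≡ b * c → k ≡ b ∸ k₀
    ka+1≡b· {k} {c} 0<k k<b eq = trans (sym (m+n∸n≡m k k₀)) (cong (_∸ k₀) k+k₀≡b)
      where
      shifted : (c + t₀) * b ≡ a * U * b + (k + k₀) * a
      shifted = begin
        (c + t₀) * b                    ≡⟨ regroupˡ c t₀ b ⟩
        b * c + t₀ * b                  ≡⟨ cong (_+ t₀ * b) (sym eq) ⟩
        N (k * a + 1) + t₀ * b          ≡⟨ cong (_+ t₀ * b) (trans (N≡ (k * a + 1)) (sym (+-assoc (a * (b * U)) (k * a) 1))) ⟩
        a * (b * U) + k * a + 1 + t₀ * b ≡⟨ regroupᵐ (a * (b * U) + k * a) t₀ b ⟩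
        a * (b * U) + k * a + (t₀ * b + 1) ≡⟨ cong (a * (b * U) + k * a +_) (sym ak₀) ⟩
        a * (b * U) + k * a + a * k₀    ≡⟨ regroupʳ a b U k k₀ ⟩
        a * U * b + (k + k₀) * a        ∎
        where
        open ≡-Reasoning
        regroupˡ : ∀ c t b → (c + t) * b ≡ b * c + t * b
        regroupˡ = solve-∀
        regroupᵐ : ∀ x t b → x + 1 + t * b ≡ x + (t * b + 1)
        regroupᵐ = solve-∀
        regroupʳ : ∀ a b U k k₀ → a * (b * U) + k * a + a * k₀ ≡ a * U * b + (k + k₀) * a
        regroupʳ = solve-∀
      k+k₀≡b : k + k₀ ≡ b
      k+k₀≡b = multiple-between (coprime-residue cba (c + t₀) (a * U) (k + k₀) shifted)
                                (≤-trans 0<k (m≤m+n k k₀)) (+-mono-< k<b k₀<b)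

    ka+1≢b·+1 : ∀ {k c} → 0 < k → k < b → N (k * a + 1) ≢ b * c + 1
    ka+1≢b·+1 {k} 0<k k<b eq =
      ka≢b· 0<k k<b (+-cancelʳ-≡ 1 _ _ (trans (+-assoc (p * q * U) (k * a) 1) eq))

    clauseA : ∀ {r} → r ≡ k₀ * a →
      Ω p q (N r) ≋ scale a (Ω p q (b * U + k₀)) ⊎ one p q (scale b (Ω p q (a * U + (a ∸ ℓ₀))))
    clauseA refl = scale∩one sa sb , sub , sup
      where
      sub : Ω p q (N (k₀ * a)) ⊆ scale a (Ω p q (b * U + k₀)) ∪ one p q (scale b (Ω p q (a * U + (a ∸ ℓ₀))))
      sub h with view-ab h
      ... | inj₁ (inj₁ sc) = inj₁ (scaled-at sa (N-ka k₀) sc)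
      ... | inj₁ (inj₂ bu) = ⊥-elim (bumped-off sa (N-ka k₀) bu)
      ... | inj₂ (inj₁ sc) = ⊥-elim (scaled-off sb k₀a≡b·+1 sc)
      ... | inj₂ (inj₂ bu) = inj₂ (bumped-at sb k₀a≡b·+1 bu)
      sup : scale a (Ω p q (b * U + k₀)) ∪ one p q (scale b (Ω p q (a * U + (a ∸ ℓ₀)))) ⊆ Ω p q (N (k₀ * a))
      sup (inj₁ h) = scaled-in sa (N-ka k₀) h
      sup (inj₂ h) = bumped-in sb k₀a≡b·+1 h

    clauseB : ∀ r → 1 < r → r < p * q → ∀ k → r ≡ k * a → k ≢ k₀ →
      Ω p q (N r) ≐ scale a (Ω p q (b * U + k))
    clauseB _ 1<r r<pq k refl k≢k₀ = sub , scaled-in sa (N-ka k)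
      where
      0<k = 0<multiplier k 1<r
      k<b = multiplier<b ≤-refl r<pq
      sub : Ω p q (N (k * a)) ⊆ scale a (Ω p q (b * U + k))
      sub h with view-ab h
      ... | inj₁ (inj₁ sc)          = scaled-at sa (N-ka k) sc
      ... | inj₁ (inj₂ bu)          = ⊥-elim (bumped-off sa (N-ka k) bu)
      ... | inj₂ (inj₁ (_ , e , _)) = ⊥-elim (ka≢b· 0<k k<b e)
      ... | inj₂ (inj₂ (_ , e , _)) = ⊥-elim (k≢k₀ (ka≡b·+1 k<b e))

    clauseC : ∀ r → 1 < r → r < p * q → ∀ k → r ≡ k * a + 1 → k ≢ b ∸ k₀ →
      Ω p q (N r) ≐ one p q (scale a (Ω p q (b * U + k)))
    clauseC _ 1<r r<pq k refl k≢ = sub , bumped-in sa (N-ka+1 k)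
      where
      0<k = 0<multiplier+1 k 1<r
      k<b = multiplier<b (m≤m+n (k * a) 1) r<pq
      sub : Ω p q (N (k * a + 1)) ⊆ one p q (scale a (Ω p q (b * U + k)))
      sub h with view-ab h
      ... | inj₁ (inj₁ sc)          = ⊥-elim (scaled-off sa (N-ka+1 k) sc)
      ... | inj₁ (inj₂ bu)          = bumped-at sa (N-ka+1 k) bu
      ... | inj₂ (inj₁ (_ , e , _)) = ⊥-elim (k≢ (ka+1≡b· 0<k k<b e))
      ... | inj₂ (inj₂ (_ , e , _)) = ⊥-elim (ka+1≢b·+1 0<k k<b e)

    bumped-offset : ∀ {r c} → N (suc r) ≡ a * c + 1 → suc r ≡ (c ∸ b * U) * a + 1
    bumped-offset {r} {c} e = trans (cong suc (offset-multiple a (b * U) c r base)) (+-comm 1 _)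
      where
      base : a * (b * U) + r ≡ a * c
      base = suc-injective (trans (sym (+-suc (a * (b * U)) r))
                                  (trans (sym (N≡ (suc r))) (trans e (+-comm (a * c) 1))))

    [b∸k₀]a+1≡ℓ₀b : (b ∸ k₀) * a + 1 ≡ ℓ₀ * b
    [b∸k₀]a+1≡ℓ₀b = trans (cong (λ x → x * a + 1) b∸k₀≡s₀) (trans (sym bℓ₀) (*-comm b ℓ₀))

    no-near : ∀ r → ¬ (∃[ k ] (r ≡ k * a)) → ¬ (∃[ k ] ((r ≡ k * a + 1) × (k ≢ b ∸ k₀))) →
      ¬ (∃[ ℓ ] (r ≡ ℓ * b)) → ∀ {λs} → ¬ Near a (N r) λs
    no-near r ¬ka _ _ (inj₁ (c , e , _)) = ¬ka (c ∸ b * U , offset-multiple a (b * U) c r (trans (sym (N≡ r)) e))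
    no-near zero ¬ka _ _ (inj₂ _) = ¬ka (0 , refl)
    no-near (suc r) _ ¬ka+1 ¬ℓb (inj₂ (c , e , _)) with (c ∸ b * U) ≟ b ∸ k₀
    ... | no  k≢ = ¬ka+1 (c ∸ b * U , bumped-offset e , k≢)
    ... | yes k≡ = ¬ℓb (ℓ₀ , trans (bumped-offset e) (trans (cong (λ x → x * a + 1) k≡) [b∸k₀]a+1≡ℓ₀b))


corollary2p2 : ∀ (p q : ℕ) → 1 < p → 1 < q → Coprime p q →
  ∀ (k₀ ℓ₀ : ℕ) → k₀ < q → (∃[ t ] (p * k₀ ≡ t * q + 1)) →
  ℓ₀ < p → (∃[ s ] (q * ℓ₀ ≡ s * p + 1)) →
  ∀ (U : ℕ) →
    (Ω p q (p * q * U)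
      ≋ scale p (Ω p q (q * U))
      ⊎ scale q (Ω p q (p * U) Relation.Unary.∖ scale p (Ω p q U)))
  × (Ω p q (p * q * U + 1)
      ≋ one p q (scale p (Ω p q (q * U)))
      ⊎ one p q (scale q (Ω p q (p * U) Relation.Unary.∖ scale p (Ω p q U))))
  × (∀ (r : ℕ) → 1 < r → r < p * q →
      (r ≡ k₀ * p →
        Ω p q (p * q * U + r)
          ≋ scale p (Ω p q (q * U + k₀))
          ⊎ one p q (scale q (Ω p q (p * U + (p ∸ ℓ₀)))))
    × (r ≡ ℓ₀ * q →
        Ω p q (p * q * U + r)
          ≋ scale q (Ω p q (p * U + ℓ₀))
          ⊎ one p q (scale p (Ω p q (q * U + (q ∸ k₀)))))
    × (∀ (k : ℕ) → r ≡ k * p → k ≢ k₀ →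
        Ω p q (p * q * U + r) Relation.Unary.≐ scale p (Ω p q (q * U + k)))
    × (∀ (k : ℕ) → r ≡ k * p + 1 → k ≢ q ∸ k₀ →
        Ω p q (p * q * U + r) Relation.Unary.≐ one p q (scale p (Ω p q (q * U + k))))
    × (∀ (ℓ : ℕ) → r ≡ ℓ * q → ℓ ≢ ℓ₀ →
        Ω p q (p * q * U + r) Relation.Unary.≐ scale q (Ω p q (p * U + ℓ)))
    × (∀ (ℓ : ℕ) → r ≡ ℓ * q + 1 → ℓ ≢ p ∸ ℓ₀ →
        Ω p q (p * q * U + r) Relation.Unary.≐ one p q (scale q (Ω p q (p * U + ℓ))))
    × (¬ (∃[ k ] (r ≡ k * p)) →
       ¬ (∃[ k ] ((r ≡ k * p + 1) × (k ≢ q ∸ k₀))) →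
       ¬ (∃[ ℓ ] (r ≡ ℓ * q)) →
       ¬ (∃[ ℓ ] ((r ≡ ℓ * q + 1) × (ℓ ≢ p ∸ ℓ₀))) →
        Empty (Ω p q (p * q * U + r))))
corollary2p2 p q 1<p 1<q cop k₀ ℓ₀ k₀<q (t₀ , pk₀) ℓ₀<p (s₀ , qℓ₀) U =
  clause-pqU U , clause-pqU+1 U , λ r 1<r r<pq →
      PQ.clauseA
    , QP.clauseA
    , PQ.clauseB r 1<r r<pq
    , PQ.clauseC r 1<r r<pq
    , QP.clauseB r 1<r r<pq
    , QP.clauseC r 1<r r<pq
    , λ ¬kp ¬kp+1 ¬ℓq ¬ℓq+1 _ h →
        Data.Sum.[ PQ.no-near r ¬kp ¬kp+1 ¬ℓq , QP.no-near r ¬ℓq ¬ℓq+1 ¬kp ] (view h)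
  where
  open Chains p q 1<p 1<q cop
  module PQ = Residues p q (inj₁ refl) (inj₂ refl) cop view refl
                k₀ ℓ₀ t₀ s₀ k₀<q pk₀ ℓ₀<p qℓ₀ U
  module QP = Residues q p (inj₂ refl) (inj₁ refl) (Coprimality.sym cop) (swap ∘ view) (*-comm q p)
                ℓ₀ k₀ s₀ t₀ ℓ₀<p qℓ₀ k₀<q pk₀ U
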